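{- Let $c$ be a nonzero rational number such that the polynomial $x^6-4x^2-c^2\in\mathbb Q[x]$ is reducible over $\mathbb Q$. Then there exists $v\in\mathbb Q$, $v\neq0$, such that $c=\dfrac{v^4+16}{8v}$. -}

module Defs where

open import Data.Nat using (ℕ; zero; suc; _∸_; _≤_)
open import Data.Integer using (+_)
open import Data.Rational using (ℚ; 0ℚ; 1ℚ; _+_; _*_; -_; _/_)
open import Data.List using (List; []; _∷_)
open import Data.Product using (Σ; _×_; ∃)
open import Relation.Binary.PropositionalEquality using (_≡_; _≢_)

-- Polynomials over ℚ as coefficient lists, lowest degree first:
-- [a₀, a₁, …, aₙ] represents a₀ + a₁ x + … + aₙ xⁿ (trailing zeros allowed).
Poly : Set
Poly = List ℚ

coeff : Poly → ℕ → ℚ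
coeff []       _       = 0ℚ
coeff (a ∷ p)  zero    = a
coeff (a ∷ p)  (suc k) = coeff p k

sumTo : ℕ → (ℕ → ℚ) → ℚ
sumTo zero    f = f zero
sumTo (suc n) f = sumTo n f + f (suc n)

mulCoeff : Poly → Poly → ℕ → ℚ
mulCoeff p q k = sumTo k (λ i → coeff p i * coeff q (k ∸ i))

NonConstant : Poly → Set
NonConstant p = Σ ℕ λ k → (1 ≤ k) × (coeff p k ≢ 0ℚ)

Reducible : Poly → Set
Reducible f = Σ Poly λ g → Σ Poly λ h →
  NonConstant g × NonConstant h × (∀ k → coeff f k ≡ mulCoeff g h k)

q : ℕ → ℚ
q n = + n / 1

P : ℚ → Poly
P c = - (c * c) ∷ 0ℚ ∷ - q 4 ∷ 0ℚ ∷ 0ℚ ∷ 0ℚ ∷ 1ℚ ∷ []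

-- If x⁶ − 4x² − c² = g·h over ℚ, normalise g and h to be monic; comparing coefficients then
-- determines the cofactor by synthetic division. A factor of degree 1 or 2, or a cubic factor
-- x³ + ax² + bx + d with d = ab (that is, (x + a)(x² + b)), yields a rational y with
-- c² = y³ − 4y. No such point has c ≠ 0: u = c/(2y), v = y/2 − u² would satisfy v² = u⁴ + 1 with
-- u ≠ 0, and clearing denominators gives a positive solution of X⁴ + Y⁴ = Z², which Fermat's
-- descent rules out. The only remaining case is a cubic factor with a² = 2b, where the coefficient
-- equations reduce to 8ad = a⁴ + 16 and c = ±d, i.e. c = (v⁴ + 16)/(8v) for v = ±a.

module Submission where

open import Defs

module FermatQuartic where
  open import Data.Nat
  open import Data.Nat.Properties
  open import Data.Nat.Coprimality as Coprime using (Coprime; coprime?; coprime-divisor; gcd≡1⇒coprime)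
  open import Data.Nat.Divisibility
  open import Data.Nat.GCD using (gcd; gcd[m,n]∣m; gcd[m,n]∣n; gcd-greatest; gcd[m,n]≢0; c*gcd[m,n]≡gcd[cm,cn])
  open import Data.Nat.Induction using (<-rec)
  open import Data.Nat.Primality using (Prime; prime; composite?; composite; euclidsLemma; prime⇒nonZero; prime⇒nonTrivial)
  open import Data.Nat.Solver using (module +-*-Solver)
  open import Data.Empty using (⊥; ⊥-elim)
  open import Data.Product using (∃-syntax; _×_; _,_)
  open import Data.Sum using (_⊎_; inj₁; inj₂)
  open import Function using (_∘_; case_of_)
  open import Relation.Nullary using (yes; no)
  open import Relation.Binary.PropositionalEquality
  open +-*-Solver using (solve; _:+_; _:*_; _:=_; con)

  infix 8 _² _⁴
  _² _⁴ : ℕ → ℕ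
  n ² = n * n
  n ⁴ = n ² ²

  Even Odd : ℕ → Set
  Even n = ∃[ k ] n ≡ 2 * k
  Odd  n = ∃[ k ] n ≡ suc (2 * k)

  even⊎odd : ∀ n → Even n ⊎ Odd n
  even⊎odd zero = inj₁ (0 , refl)
  even⊎odd (suc n) with even⊎odd n
  ... | inj₁ (k , refl) = inj₂ (k , refl)
  ... | inj₂ (k , refl) = inj₁ (suc k , sym (*-suc 2 k))

  odd²≡1+4* : ∀ {n} → Odd n → ∃[ t ] n ² ≡ suc (4 * t)
  odd²≡1+4* (k , refl) = k + k * k ,
    solve 1 (λ k → (con 1 :+ con 2 :* k) :* (con 1 :+ con 2 :* k) := con 1 :+ con 4 :* (k :+ k :* k)) refl k

  odd⇒odd² : ∀ {n} → Odd n → Odd (n ²)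
  odd⇒odd² on with odd²≡1+4* on
  ... | t , eq = 2 * t , trans eq (cong suc (*-assoc 2 2 t))

  [2*n]²≡2*[2*n²] : ∀ n → (2 * n) ² ≡ 2 * (2 * n ²)
  [2*n]²≡2*[2*n²] = solve 1 (λ n → con 2 :* n :* (con 2 :* n) := con 2 :* (con 2 :* (n :* n))) refl

  even⇒even² : ∀ {n} → Even n → Even (n ²)
  even⇒even² (k , refl) = 2 * k ² , [2*n]²≡2*[2*n²] k

  odd²+odd²≡2*odd : ∀ {x y} → Odd x → Odd y → ∃[ t ] x ² + y ² ≡ 2 * suc (2 * t)
  odd²+odd²≡2*odd ox oy with odd²≡1+4* ox | odd²≡1+4* oy
  ... | a , x²≡ | b , y²≡ = a + b , trans (cong₂ _+_ x²≡ y²≡)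
    (solve 2 (λ a b → (con 1 :+ con 4 :* a) :+ (con 1 :+ con 4 :* b) := con 2 :* (con 1 :+ con 2 :* (a :+ b))) refl a b)

  odd²+odd²≢² : ∀ {x y} z → Odd x → Odd y → x ² + y ² ≢ z ²
  odd²+odd²≢² {x} {y} z ox oy eq with odd²+odd²≡2*odd ox oy | even⊎odd z
  ... | t , sum≡ | inj₁ (k , refl) = even≢odd (k * k) t (sym (*-cancelˡ-≡ _ _ 2 (begin
      2 * suc (2 * t)     ≡⟨ sum≡ ⟨
      x ² + y ²           ≡⟨ eq ⟩
      (2 * k) ²           ≡⟨ [2*n]²≡2*[2*n²] k ⟩
      2 * (2 * (k * k))   ∎)))
    where open ≡-Reasoning
  ... | t , sum≡ | inj₂ oz with odd²≡1+4* oz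
  ...   | u , z²≡ = even≢odd (suc (2 * t)) (2 * u) (begin
      2 * suc (2 * t)     ≡⟨ sum≡ ⟨
      x ² + y ²           ≡⟨ eq ⟩
      z ²                 ≡⟨ z²≡ ⟩
      suc (4 * u)         ≡⟨ cong suc (*-assoc 2 2 u) ⟩
      suc (2 * (2 * u))   ∎)
    where open ≡-Reasoning

  coprime-∣ : ∀ {a b c d} → Coprime a b → c ∣ a → d ∣ b → Coprime c d
  coprime-∣ cab c∣a d∣b (e∣c , e∣d) = cab (∣-trans e∣c c∣a , ∣-trans e∣d d∣b)

  coprime-*ʳ : ∀ {a b c} → Coprime a b → Coprime a c → Coprime a (b * c)
  coprime-*ʳ cab cac (d∣a , d∣bc) = cac (d∣a , coprime-divisor (coprime-∣ cab d∣a ∣-refl) d∣bc)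

  coprime-² : ∀ {a b} → Coprime a b → Coprime (a ²) (b ²)
  coprime-² {a} {b} cab = Coprime.sym (coprime-*ʳ cb²a cb²a)
    where
    cb²a : Coprime (b ²) a
    cb²a = Coprime.sym (coprime-*ʳ cab cab)

  coprime*≡²⇒≡gcd² : ∀ {a b} n → Coprime a b → a * b ≡ n ² → a ≡ (gcd a n) ²
  coprime*≡²⇒≡gcd² {a} {b} n cab ab≡n² = ∣-antisym a∣g² g²∣a
    where
    g = gcd a n
    a∣g*n : a ∣ g * n
    a∣g*n = subst (a ∣_) (trans (sym (c*gcd[m,n]≡gcd[cm,cn] n a n)) (*-comm n g))
                  (gcd-greatest (n∣m*n n) (subst (a ∣_) ab≡n² (m∣m*n b)))
    a∣g² : a ∣ g ²
    a∣g² = subst (a ∣_) (sym (c*gcd[m,n]≡gcd[cm,cn] g a n)) (gcd-greatest (n∣m*n g) a∣g*n)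
    coprime[b,g] : Coprime b g
    coprime[b,g] = coprime-∣ (Coprime.sym cab) ∣-refl (gcd[m,n]∣m a n)
    g²∣a : g ² ∣ a
    g²∣a = coprime-divisor (Coprime.sym (coprime-*ʳ coprime[b,g] coprime[b,g]))
             (subst (g ² ∣_) (trans (sym ab≡n²) (*-comm a b)) (*-pres-∣ (gcd[m,n]∣n a n) (gcd[m,n]∣n a n)))

  coprime-+² : ∀ {k l} → Coprime k l → Coprime k (k ² + l ²)
  coprime-+² {k} ckl {d} (d∣k , d∣K) = coprime-*ʳ ckl ckl (d∣k , ∣m+n∣m⇒∣n d∣K (∣m⇒∣m*n k d∣k))

  coprime-leg : ∀ {x r s} → Coprime r s → x ² + s ² ≡ r ² → Coprime x s
  coprime-leg {x} {r} {s} crs x²+s²≡r² {d} (d∣x , d∣s) = coprime-*ʳ (Coprime.sym crs) (Coprime.sym crs)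
    (d∣s , subst (d ∣_) x²+s²≡r² (∣m∣n⇒∣m+n (∣m⇒∣m*n x d∣x) (∣m⇒∣m*n s d∣s)))

  m²≤n²⇒m≤n : ∀ {m n} → m ² ≤ n ² → m ≤ n
  m²≤n²⇒m≤n m²≤n² = ≮⇒≥ λ n<m → <⇒≱ (*-mono-< n<m n<m) m²≤n²

  m²≡n²⇒m≡n : ∀ {m n} → m ² ≡ n ² → m ≡ n
  m²≡n²⇒m≡n eq = ≤-antisym (m²≤n²⇒m≤n (≤-reflexive eq)) (m²≤n²⇒m≤n (≤-reflexive (sym eq)))

  record PythagoreanParameters (A B C : ℕ) : Set where
    field
      r s     : ℕ
      coprime : Coprime r s
      A+s²≡r² : A + s ² ≡ r ²
      B≡2rs   : B ≡ 2 * (r * s)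
      C≡r²+s² : C ≡ r ² + s ²

  pythagorean-triple : ∀ {A B} C → Coprime A B → Odd A → Even B → A ² + B ² ≡ C ² → PythagoreanParameters A B C
  pythagorean-triple {A} {B} C cAB (i , refl) (j , refl) eq with even⊎odd C
  ... | inj₁ (k , refl) = ⊥-elim (even≢odd (2 * (k * k)) (2 * (i + i * i) + 2 * (j * j)) (begin
      2 * (2 * k ²)                               ≡⟨ [2*n]²≡2*[2*n²] k ⟨
      (2 * k) ²                                   ≡⟨ eq ⟨
      A ² + B ²                                   ≡⟨ odd²+even² i j ⟩
      suc (2 * (2 * (i + i * i) + 2 * (j * j)))   ∎))
    where
    open ≡-Reasoning
    odd²+even² : ∀ i j → (suc (2 * i)) ² + (2 * j) ² ≡ suc (2 * (2 * (i + i * i) + 2 * (j * j)))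
    odd²+even² = solve 2 (λ i j → (con 1 :+ con 2 :* i) :* (con 1 :+ con 2 :* i) :+ con 2 :* j :* (con 2 :* j)
                                  := con 1 :+ con 2 :* (con 2 :* (i :+ i :* i) :+ con 2 :* (j :* j))) refl
  ... | inj₂ (c , refl) with m≤n⇒∃[o]m+o≡n i≤c
    where
    i≤c : i ≤ c
    i≤c = *-cancelˡ-≤ 2 (≤-pred (m²≤n²⇒m≤n (≤-trans (m≤m+n (A ²) (B ²)) (≤-reflexive eq))))
  ... | u , refl = record
    { r = r ; s = s ; coprime = coprime[r,s] ; A+s²≡r² = A+s²≡r² ; B≡2rs = cong (2 *_) j≡rs ; C≡r²+s² = C≡r²+s² }
    where
    open ≡-Reasoning
    w = A + u
    j²≡uw : j ² ≡ u * w
    j²≡uw = *-cancelˡ-≡ _ _ 4 (+-cancelˡ-≡ (A ²) _ _ (begin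
      A ² + 4 * j ²                 ≡⟨ cong (A ² +_) (trans ([2*n]²≡2*[2*n²] j) (sym (*-assoc 2 2 (j ²)))) ⟨
      A ² + B ²                     ≡⟨ eq ⟩
      C ²                           ≡⟨ expand-C i u ⟩
      A ² + 4 * (u * w)             ∎))
      where
      expand-C : ∀ i u → (suc (2 * (i + u))) ² ≡ (suc (2 * i)) ² + 4 * (u * (suc (2 * i) + u))
      expand-C = solve 2 (λ i u → (con 1 :+ con 2 :* (i :+ u)) :* (con 1 :+ con 2 :* (i :+ u))
                                  := (con 1 :+ con 2 :* i) :* (con 1 :+ con 2 :* i) :+ con 4 :* (u :* (con 1 :+ con 2 :* i :+ u))) refl
    coprime[A,j²] : Coprime A (j ²)
    coprime[A,j²] = coprime-*ʳ coprime[A,j] coprime[A,j]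
      where
      coprime[A,j] : Coprime A j
      coprime[A,j] = coprime-∣ cAB ∣-refl (n∣m*n 2)
    coprime[u,w] : Coprime u w
    coprime[u,w] {d} (d∣u , d∣w) =
      coprime[A,j²] (∣m+n∣m⇒∣n (subst (d ∣_) (+-comm A u) d∣w) d∣u , subst (d ∣_) (sym j²≡uw) (∣m⇒∣m*n w d∣u))
    s = gcd u j
    r = gcd w j
    u≡s² : u ≡ s ²
    u≡s² = coprime*≡²⇒≡gcd² j coprime[u,w] (sym j²≡uw)
    w≡r² : w ≡ r ²
    w≡r² = coprime*≡²⇒≡gcd² j (Coprime.sym coprime[u,w]) (trans (*-comm w u) (sym j²≡uw))
    coprime[r,s] : Coprime r s
    coprime[r,s] = coprime-∣ (Coprime.sym coprime[u,w]) (gcd[m,n]∣m w j) (gcd[m,n]∣m u j)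
    A+s²≡r² : A + s ² ≡ r ²
    A+s²≡r² = trans (cong (A +_) (sym u≡s²)) w≡r²
    j≡rs : j ≡ r * s
    j≡rs = m²≡n²⇒m≡n (begin
      j ²                 ≡⟨ j²≡uw ⟩
      u * w               ≡⟨ *-comm u w ⟩
      w * u               ≡⟨ cong₂ _*_ w≡r² u≡s² ⟩
      r ² * s ²           ≡⟨ [m*n]*[o*p]≡[m*o]*[n*p] r r s s ⟩
      (r * s) ²           ∎)
    C≡r²+s² : C ≡ r ² + s ²
    C≡r²+s² = begin
      C                   ≡⟨ solve 2 (λ i u → con 1 :+ con 2 :* (i :+ u) := (con 1 :+ con 2 :* i :+ u) :+ u) refl i u ⟩
      w + u               ≡⟨ cong₂ _+_ w≡r² u≡s² ⟩
      r ² + s ²           ∎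

  prime-factor : ∀ n → 1 < n → ∃[ p ] Prime p × p ∣ n
  prime-factor = <-rec _ step
    where
    step : ∀ n → (∀ {m} → m < n → 1 < m → ∃[ p ] Prime p × p ∣ m) → 1 < n → ∃[ p ] Prime p × p ∣ n
    step n rec 1<n with composite? n
    ... | yes (composite d<n d∣n) = let p , pp , p∣d = rec d<n (nonTrivial⇒n>1 _) in p , pp , ∣-trans p∣d d∣n
    ... | no ¬composite = n , prime {{n>1⇒nonTrivial 1<n}} ¬composite , ∣-refl

  prime∣²⇒prime∣ : ∀ {p} n → Prime p → p ∣ n ² → p ∣ n
  prime∣²⇒prime∣ n pp p∣n² with euclidsLemma n n pp p∣n²
  ... | inj₁ p∣n = p∣n
  ... | inj₂ p∣n = p∣n

  square-quotient-by-prime² : ∀ {p} a z → Prime p → a * p ² ≡ z ² → ∃[ z′ ] z ≡ z′ * p × a ≡ z′ ²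
  square-quotient-by-prime² {p} a z pp eq
    with prime∣²⇒prime∣ z pp (divides (a * p) (trans (sym eq) (sym (*-assoc a p p))))
  ... | divides z′ refl = z′ , refl , *-cancelʳ-≡ a (z′ ²) (p ²) {{m*n≢0 p p}} (begin
      a * p ²             ≡⟨ eq ⟩
      (z′ * p) ²          ≡⟨ [m*n]*[o*p]≡[m*o]*[n*p] z′ p z′ p ⟩
      z′ ² * p ²          ∎)
    where
    open ≡-Reasoning
    instance _ = prime⇒nonZero pp

  divide-common-prime : ∀ {p x y} z → Prime p → (x * p) ⁴ + (y * p) ⁴ ≡ z ² →
                        ∃[ z′ ] z ≡ z′ * p * p × x ⁴ + y ⁴ ≡ z′ ²
  divide-common-prime {p} {x} {y} z pp eq
    with square-quotient-by-prime² ((x ⁴ + y ⁴) * p ²) z pp (trans (factor x y p) eq)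
    where
    factor : ∀ x y p → (x ⁴ + y ⁴) * p ² * p ² ≡ (x * p) ⁴ + (y * p) ⁴
    factor = solve 3 (λ x y p → (x :* x :* (x :* x) :+ y :* y :* (y :* y)) :* (p :* p) :* (p :* p)
                                := x :* p :* (x :* p) :* (x :* p :* (x :* p)) :+ y :* p :* (y :* p) :* (y :* p :* (y :* p))) refl
  ... | z₁ , refl , eq₁ with square-quotient-by-prime² (x ⁴ + y ⁴) z₁ pp eq₁
  ... | z′ , refl , eq′ = z′ , refl , eq′

  coprime-triple-squares : ∀ {k l m} n → Coprime k l → Coprime k m → Coprime l m → k * (l * m) ≡ n ² →
                           ∃[ α ] ∃[ β ] ∃[ γ ] k ≡ α ² × l ≡ β ² × m ≡ γ ²
  coprime-triple-squares {k} {l} {m} n ckl ckm clm eq =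
    gcd k n , gcd l n′ , gcd m n′ , coprime*≡²⇒≡gcd² n ck[lm] eq ,
    coprime*≡²⇒≡gcd² n′ clm lm≡n′² , coprime*≡²⇒≡gcd² n′ (Coprime.sym clm) (trans (*-comm m l) lm≡n′²)
    where
    ck[lm] : Coprime k (l * m)
    ck[lm] = coprime-*ʳ ckl ckm
    n′ = gcd (l * m) n
    lm≡n′² : l * m ≡ n′ ²
    lm≡n′² = coprime*≡²⇒≡gcd² n (Coprime.sym ck[lm]) (trans (*-comm (l * m) k) eq)

  *-positiveˡ : ∀ {m n} → 0 < m * n → 0 < m
  *-positiveˡ {suc m} _ = z<s

  *-positiveʳ : ∀ m {n} → 0 < m * n → 0 < n
  *-positiveʳ m {n} 0<mn = *-positiveˡ {n} (subst (0 <_) (*-comm m n) 0<mn)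

  root-positive : ∀ {n m} → 0 < n → n ≡ m ² → 0 < m
  root-positive {m = m} n>0 n≡m² = *-positiveˡ {m} (subst (0 <_) n≡m² n>0)

  n≤n² : ∀ n → n ≤ n ²
  n≤n² zero    = z≤n
  n≤n² (suc n) = m≤m*n (suc n) (suc n)

  -- x² = r² − s², y² = 2rs, z = r² + s² with s even; parametrising (x, s, r) once more turns
  -- (y/2)² = kl(k² + l²) into three coprime squares α², β², γ² with α⁴ + β⁴ = γ² and γ < z.
  primitive-descent : ∀ {x y} z → Coprime x y → Odd x → Even y → 0 < y → x ⁴ + y ⁴ ≡ z ² →
    ∃[ α ] ∃[ β ] ∃[ γ ] 0 < α × 0 < β × γ < z × α ⁴ + β ⁴ ≡ γ ²
  primitive-descent {x} z cxy ox (y₁ , refl) y>0 eq = case even⊎odd s of λ where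
      (inj₂ os) → ⊥-elim (odd²+odd²≢² r ox os A+s²≡r²)
      (inj₁ es) → descend es
    where
    open PythagoreanParameters (pythagorean-triple z (coprime-² cxy) (odd⇒odd² ox) (even⇒even² (y₁ , refl)) eq)
    s>0 : 0 < s
    s>0 = *-positiveʳ r (*-positiveʳ 2 (subst (0 <_) B≡2rs (*-mono-< y>0 y>0)))
    descend : Even s → ∃[ α ] ∃[ β ] ∃[ γ ] 0 < α × 0 < β × γ < z × α ⁴ + β ⁴ ≡ γ ²
    descend es = case coprime-triple-squares y₁ ck[l] ck[K] cl[K] klK≡y₁² of λ where
        (α , β , γ , k≡α² , l≡β² , K≡γ²) →
          α , β , γ , root-positive k>0 k≡α² , root-positive l>0 l≡β² , γ<z K≡γ² ,
          trans (cong₂ (λ a b → a ² + b ²) (sym k≡α²) (sym l≡β²)) K≡γ²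
      where
      open PythagoreanParameters (pythagorean-triple r (coprime-leg {x} coprime A+s²≡r²) ox es A+s²≡r²)
        renaming (r to k; s to l; coprime to ck[l]; B≡2rs to s≡2kl; C≡r²+s² to r≡k²+l²)
      K = k ² + l ²
      ck[K] : Coprime k K
      ck[K] = coprime-+² ck[l]
      cl[K] : Coprime l K
      cl[K] = subst (Coprime l) (+-comm (l ²) (k ²)) (coprime-+² (Coprime.sym ck[l]))
      klK≡y₁² : k * (l * K) ≡ y₁ ²
      klK≡y₁² = *-cancelˡ-≡ _ _ 4 (begin
        4 * (k * (l * K))                   ≡⟨ solve 2 (λ k l → con 4 :* (k :* (l :* (k :* k :+ l :* l)))
                                                            := con 2 :* ((k :* k :+ l :* l) :* (con 2 :* (k :* l)))) refl k l ⟩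
        2 * (K * (2 * (k * l)))             ≡⟨ cong₂ (λ a b → 2 * (a * b)) r≡k²+l² s≡2kl ⟨
        2 * (r * s)                         ≡⟨ B≡2rs ⟨
        (2 * y₁) ²                          ≡⟨ [2*n]²≡2*[2*n²] y₁ ⟩
        2 * (2 * y₁ ²)                      ≡⟨ *-assoc 2 2 (y₁ ²) ⟨
        4 * y₁ ²                            ∎)
        where open ≡-Reasoning
      kl>0 : 0 < k * l
      kl>0 = *-positiveʳ 2 (subst (0 <_) s≡2kl s>0)
      k>0 : 0 < k
      k>0 = *-positiveˡ kl>0
      l>0 : 0 < l
      l>0 = *-positiveʳ k kl>0
      γ<z : ∀ {γ} → K ≡ γ ² → γ < z
      γ<z {γ} K≡γ² = begin-strict
        γ               ≤⟨ n≤n² γ ⟩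
        γ ²             ≡⟨ K≡γ² ⟨
        K               ≡⟨ r≡k²+l² ⟨
        r               ≤⟨ n≤n² r ⟩
        r ²             <⟨ m<m+n (r ²) (*-mono-< s>0 s>0) ⟩
        r ² + s ²       ≡⟨ C≡r²+s² ⟨
        z               ∎
        where open ≤-Reasoning

  QuarticSumNotSquare : ℕ → Set
  QuarticSumNotSquare z = ∀ {x y} → 0 < x → 0 < y → x ⁴ + y ⁴ ≢ z ²

  quartic-sum-not-square : ∀ z → QuarticSumNotSquare z
  quartic-sum-not-square = <-rec QuarticSumNotSquare descent
    where
    descent : ∀ z → (∀ {z′} → z′ < z → QuarticSumNotSquare z′) → QuarticSumNotSquare z
    descent z ih {x} {y} x>0 y>0 eq with coprime? x y
    ... | yes cxy = by-parity (even⊎odd x) (even⊎odd y)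
      where
      smaller : ∀ {x y} → Coprime x y → Odd x → Even y → 0 < y → x ⁴ + y ⁴ ≡ z ² → ⊥
      smaller cxy ox ey y>0 eq with primitive-descent z cxy ox ey y>0 eq
      ... | α , β , γ , α>0 , β>0 , γ<z , eq′ = ih γ<z α>0 β>0 eq′
      by-parity : Even x ⊎ Odd x → Even y ⊎ Odd y → ⊥
      by-parity (inj₂ ox) (inj₂ oy) = odd²+odd²≢² z (odd⇒odd² ox) (odd⇒odd² oy) eq
      by-parity (inj₁ (a , refl)) (inj₁ (b , refl)) with cxy (m∣m*n {2} a , m∣m*n b)
      ... | ()
      by-parity (inj₂ ox) (inj₁ ey) = smaller cxy ox ey y>0 eq
      by-parity (inj₁ ex) (inj₂ oy) = smaller (Coprime.sym cxy) oy ex x>0 (trans (+-comm (y ⁴) (x ⁴)) eq)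
    ... | no ¬cxy with prime-factor (gcd x y) 1<gcd
      where
      1<gcd : 1 < gcd x y
      1<gcd = ≤∧≢⇒< (n≢0⇒n>0 (gcd[m,n]≢0 x y (inj₁ (>⇒≢ x>0)))) (¬cxy ∘ gcd≡1⇒coprime ∘ sym)
    ... | p , pp , p∣g with ∣-trans p∣g (gcd[m,n]∣m x y) | ∣-trans p∣g (gcd[m,n]∣n x y)
    ... | divides x′ refl | divides y′ refl with divide-common-prime {x = x′} {y′} z pp eq
    ... | z′ , refl , eq′ = ih z′<z x′>0 (*-positiveˡ {y′} y>0) eq′
      where
      x′>0 : 0 < x′
      x′>0 = *-positiveˡ x>0
      z′>0 : 0 < z′
      z′>0 = *-positiveˡ {z′} (subst (0 <_) eq′ (<-≤-trans (*-mono-< (*-mono-< x′>0 x′>0) (*-mono-< x′>0 x′>0)) (m≤m+n _ _)))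
      instance
        _ = prime⇒nonZero pp
        _ = >-nonZero z′>0
      z′<z : z′ < z′ * p * p
      z′<z = <-≤-trans (m<m*n z′ p (nonTrivial⇒n>1 p {{prime⇒nonTrivial pp}})) (m≤m*n (z′ * p) p)

module QuarticPoints where
  open import Data.Nat as ℕ using (ℕ; suc; _<_; z<s)
  import Data.Nat.Properties as ℕ
  open import Data.Nat.Solver using (module +-*-Solver)
  open import Data.Integer as ℤ using (ℤ; +_; -[1+_]; ∣_∣)
  import Data.Integer.Properties as ℤ
  open import Data.Rational using (mkℚ; 0ℚ; 1ℚ; _*_; _+_; toℚᵘ)
  open import Data.Rational.Properties using (toℚᵘ-homo-*; toℚᵘ-homo-+; toℚᵘ-cong; ↥p≡0⇒p≡0)
  import Data.Rational.Unnormalised as ℚᵘ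
  open import Data.Rational.Unnormalised using (*≡*)
  import Data.Rational.Unnormalised.Properties as ℚᵘ
  open import Relation.Binary.PropositionalEquality
  open FermatQuartic using (_²; _⁴; quartic-sum-not-square)
  open +-*-Solver using (solve; _:+_; _:*_; _:=_; con)

  toℚᵘ-quartic-plus-one : ∀ u v → v * v ≡ u * u * u * u + 1ℚ →
    toℚᵘ v ℚᵘ.* toℚᵘ v ℚᵘ.≃ toℚᵘ u ℚᵘ.* toℚᵘ u ℚᵘ.* toℚᵘ u ℚᵘ.* toℚᵘ u ℚᵘ.+ ℚᵘ.1ℚᵘ
  toℚᵘ-quartic-plus-one u v eq = begin
    toℚᵘ v ℚᵘ.* toℚᵘ v                                    ≈⟨ toℚᵘ-homo-* v v ⟨
    toℚᵘ (v * v)                                          ≈⟨ toℚᵘ-cong eq ⟩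
    toℚᵘ (u * u * u * u + 1ℚ)                             ≈⟨ toℚᵘ-homo-+ (u * u * u * u) 1ℚ ⟩
    toℚᵘ (u * u * u * u) ℚᵘ.+ ℚᵘ.1ℚᵘ                      ≈⟨ ℚᵘ.+-congˡ ℚᵘ.1ℚᵘ toℚᵘ-u⁴ ⟩
    toℚᵘ u ℚᵘ.* toℚᵘ u ℚᵘ.* toℚᵘ u ℚᵘ.* toℚᵘ u ℚᵘ.+ ℚᵘ.1ℚᵘ ∎
    where
    open ℚᵘ.≃-Reasoning
    toℚᵘ-u⁴ : toℚᵘ (u * u * u * u) ℚᵘ.≃ toℚᵘ u ℚᵘ.* toℚᵘ u ℚᵘ.* toℚᵘ u ℚᵘ.* toℚᵘ u
    toℚᵘ-u⁴ = ℚᵘ.≃-trans (toℚᵘ-homo-* (u * u * u) u)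
                (ℚᵘ.*-congʳ (ℚᵘ.≃-trans (toℚᵘ-homo-* (u * u) u) (ℚᵘ.*-congʳ (toℚᵘ-homo-* u u))))

  i*i≡+∣i∣² : ∀ i → i ℤ.* i ≡ + (∣ i ∣ ²)
  i*i≡+∣i∣² (+ n)    = sym (ℤ.pos-* n n)
  i*i≡+∣i∣² -[1+ n ] = refl

  i⁴≡+∣i∣⁴ : ∀ i → i ℤ.* i ℤ.* i ℤ.* i ≡ + (∣ i ∣ ⁴)
  i⁴≡+∣i∣⁴ i = begin
    i ℤ.* i ℤ.* i ℤ.* i                 ≡⟨ ℤ.*-assoc (i ℤ.* i) i i ⟩
    i ℤ.* i ℤ.* (i ℤ.* i)               ≡⟨ cong₂ ℤ._*_ (i*i≡+∣i∣² i) (i*i≡+∣i∣² i) ⟩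
    + (∣ i ∣ ²) ℤ.* + (∣ i ∣ ²)             ≡⟨ ℤ.pos-* (∣ i ∣ ²) (∣ i ∣ ²) ⟨
    + (∣ i ∣ ⁴)                           ∎
    where open ≡-Reasoning

  -- The hypothesis is the cross-multiplied form of toℚᵘ-quartic-plus-one for u = a/D, v = b/E.
  cleared-denominators : ∀ a b D E →
    b ℤ.* b ℤ.* + (D ℕ.* D ℕ.* D ℕ.* D ℕ.* 1) ≡
      (a ℤ.* a ℤ.* a ℤ.* a ℤ.* + 1 ℤ.+ + 1 ℤ.* + (D ℕ.* D ℕ.* D ℕ.* D)) ℤ.* + (E ℕ.* E) →
    (∣ a ∣ ℕ.* E) ⁴ ℕ.+ (D ℕ.* E) ⁴ ≡ (∣ b ∣ ℕ.* D ℕ.* D ℕ.* E) ²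
  cleared-denominators a b D E eq = begin
    (α ℕ.* E) ⁴ ℕ.+ (D ℕ.* E) ⁴                 ≡⟨ spread α D E ⟩
    (α ⁴ ℕ.* 1 ℕ.+ 1 ℕ.* D⁴) ℕ.* E ² ℕ.* E ²    ≡⟨ cong (ℕ._* E ²) (ℤ.+-injective natural-equation) ⟨
    β ² ℕ.* (D⁴ ℕ.* 1) ℕ.* E ²                  ≡⟨ gather β D E ⟩
    (β ℕ.* D ℕ.* D ℕ.* E) ²                     ∎
    where
    open ≡-Reasoning
    α = ∣ a ∣
    β = ∣ b ∣
    D⁴ = D ℕ.* D ℕ.* D ℕ.* D
    spread : ∀ α D E → (α ℕ.* E) ⁴ ℕ.+ (D ℕ.* E) ⁴ ≡ (α ⁴ ℕ.* 1 ℕ.+ 1 ℕ.* (D ℕ.* D ℕ.* D ℕ.* D)) ℕ.* E ² ℕ.* E ²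
    spread = solve 3 (λ α D E → α :* E :* (α :* E) :* (α :* E :* (α :* E)) :+ D :* E :* (D :* E) :* (D :* E :* (D :* E))
                                := (α :* α :* (α :* α) :* con 1 :+ con 1 :* (D :* D :* D :* D)) :* (E :* E) :* (E :* E)) refl
    gather : ∀ β D E → β ² ℕ.* (D ℕ.* D ℕ.* D ℕ.* D ℕ.* 1) ℕ.* E ² ≡ (β ℕ.* D ℕ.* D ℕ.* E) ²
    gather = solve 3 (λ β D E → β :* β :* (D :* D :* D :* D :* con 1) :* (E :* E) := β :* D :* D :* E :* (β :* D :* D :* E)) refl
    natural-equation : + (β ² ℕ.* (D⁴ ℕ.* 1)) ≡ + ((α ⁴ ℕ.* 1 ℕ.+ 1 ℕ.* D⁴) ℕ.* E ²)
    natural-equation = begin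
      + (β ² ℕ.* (D⁴ ℕ.* 1))                        ≡⟨ ℤ.pos-* (β ²) (D⁴ ℕ.* 1) ⟩
      + (β ²) ℤ.* + (D⁴ ℕ.* 1)                        ≡⟨ cong (ℤ._* + (D⁴ ℕ.* 1)) (i*i≡+∣i∣² b) ⟨
      b ℤ.* b ℤ.* + (D⁴ ℕ.* 1)                      ≡⟨ eq ⟩
      (a ℤ.* a ℤ.* a ℤ.* a ℤ.* + 1 ℤ.+ + 1 ℤ.* + D⁴) ℤ.* + (E ²)
                                                    ≡⟨ cong (λ i → (i ℤ.* + 1 ℤ.+ + 1 ℤ.* + D⁴) ℤ.* + (E ²)) (i⁴≡+∣i∣⁴ a) ⟩
      (+ (α ⁴) ℤ.* + 1 ℤ.+ + 1 ℤ.* + D⁴) ℤ.* + (E ²)    ≡⟨ cong (ℤ._* + (E ²)) (cong₂ ℤ._+_ (ℤ.pos-* (α ⁴) 1) (ℤ.pos-* 1 D⁴)) ⟨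
      (+ (α ⁴ ℕ.* 1) ℤ.+ + (1 ℕ.* D⁴)) ℤ.* + (E ²)    ≡⟨ cong (ℤ._* + (E ²)) (ℤ.pos-+ (α ⁴ ℕ.* 1) (1 ℕ.* D⁴)) ⟨
      + (α ⁴ ℕ.* 1 ℕ.+ 1 ℕ.* D⁴) ℤ.* + (E ²)          ≡⟨ ℤ.pos-* (α ⁴ ℕ.* 1 ℕ.+ 1 ℕ.* D⁴) (E ²) ⟨
      + ((α ⁴ ℕ.* 1 ℕ.+ 1 ℕ.* D⁴) ℕ.* E ²)          ∎

  u⁴+1≢v² : ∀ u v → u ≢ 0ℚ → v * v ≢ u * u * u * u + 1ℚ
  u⁴+1≢v² u@(mkℚ a d _) v@(mkℚ b e _) u≢0 eq with toℚᵘ-quartic-plus-one u v eq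
  ... | *≡* eqℤ = quartic-sum-not-square (∣ b ∣ ℕ.* suc d ℕ.* suc d ℕ.* suc e) {y = suc d ℕ.* suc e} αE>0 z<s
                    (cleared-denominators a b (suc d) (suc e) eqℤ)
    where
    αE>0 : 0 < ∣ a ∣ ℕ.* suc e
    αE>0 = ℕ.*-mono-< (ℕ.n≢0⇒n>0 (λ α≡0 → u≢0 (↥p≡0⇒p≡0 u (ℤ.∣i∣≡0⇒i≡0 α≡0)))) z<s

module Combinations where
  open import Data.Rational using (ℚ; 0ℚ; 1ℚ; _+_; _*_; _-_; 1/_; ≢-nonZero)
  import Data.Rational.Properties as ℚ
  open import Algebra.Properties.Group ℚ.+-0-group using (x∙y⁻¹≈ε⇒x≈y)
  open import Data.Sum using (_⊎_; inj₁; inj₂)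
  open import Relation.Nullary using (yes; no)
  open import Relation.Binary.PropositionalEquality

  zero-* : ∀ {x} y → x ≡ 0ℚ → y * x ≡ 0ℚ
  zero-* y refl = ℚ.*-zeroʳ y

  zero-+ : ∀ {x y} → x ≡ 0ℚ → y ≡ 0ℚ → x + y ≡ 0ℚ
  zero-+ refl refl = refl

  difference : ∀ {x y} → x ≡ y → x - y ≡ 0ℚ
  difference {x} refl = ℚ.+-inverseʳ x

  by-combination : ∀ {x y s} → s ≡ 0ℚ → x - y ≡ s → x ≡ y
  by-combination {x} {y} s≡0 eq = x∙y⁻¹≈ε⇒x≈y x y (trans eq s≡0)

  p*q≡0⇒p≡0∨q≡0 : ∀ p q → p * q ≡ 0ℚ → p ≡ 0ℚ ⊎ q ≡ 0ℚ
  p*q≡0⇒p≡0∨q≡0 p q pq≡0 with p ℚ.≟ 0ℚ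
  ... | yes p≡0 = inj₁ p≡0
  ... | no p≢0 = inj₂ (begin
    q                   ≡⟨ ℚ.*-identityˡ q ⟨
    1ℚ * q              ≡⟨ cong (_* q) (ℚ.*-inverseˡ p) ⟨
    1/ p * p * q        ≡⟨ ℚ.*-assoc (1/ p) p q ⟩
    1/ p * (p * q)      ≡⟨ cong (1/ p *_) pq≡0 ⟩
    1/ p * 0ℚ           ≡⟨ ℚ.*-zeroʳ (1/ p) ⟩
    0ℚ                  ∎)
    where
    open ≡-Reasoning
    instance _ = ≢-nonZero p≢0

module CurvePoints where
  open import Data.Rational using (ℚ; 0ℚ; 1ℚ; ½; _+_; _*_; -_; _-_; 1/_; ≢-nonZero)
  import Data.Rational.Properties as ℚ
  open import Data.Rational.Solver using (module +-*-Solver)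
  open import Data.Sum using (inj₁; inj₂)
  open import Data.Empty using (⊥-elim)
  open import Relation.Nullary using (yes; no)
  open import Relation.Binary.PropositionalEquality
  open QuarticPoints using (u⁴+1≢v²)
  open Combinations using (zero-*; zero-+; difference; by-combination; p*q≡0⇒p≡0∨q≡0)
  open +-*-Solver using (solve; _:+_; _:*_; _:-_; :-_; _:=_; con)

  curve⇒quartic : ∀ c y i → c * c ≡ y * y * y - q 4 * y → q 2 * y * i ≡ 1ℚ →
    (y * ½ - c * i * (c * i)) * (y * ½ - c * i * (c * i)) ≡ c * i * (c * i) * (c * i) * (c * i) + 1ℚ
  curve⇒quartic c y i on-curve 2yi≡1 = by-combination
    (zero-+ (zero-* (- (y * i * i)) (difference on-curve))
            (zero-* (- (½ * ½) * ((q 2 * y * i + 1ℚ) * (y * y - q 4))) (difference 2yi≡1)))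
    (solve 3 (λ c y i →
       (y :* con ½ :- c :* i :* (c :* i)) :* (y :* con ½ :- c :* i :* (c :* i)) :- (c :* i :* (c :* i) :* (c :* i) :* (c :* i) :+ con 1ℚ)
       := :- (y :* i :* i) :* (c :* c :- (y :* y :* y :- con (q 4) :* y))
          :+ :- (con ½ :* con ½) :* ((con (q 2) :* y :* i :+ con 1ℚ) :* (y :* y :- con (q 4))) :* (con (q 2) :* y :* i :- con 1ℚ))
       refl c y i)

  curve-point-on-axis : ∀ {c y} → c * c ≡ y * y * y - q 4 * y → c ≡ 0ℚ
  curve-point-on-axis {c} {y} on-curve with c ℚ.≟ 0ℚ | y ℚ.≟ 0ℚ
  ... | yes c≡0 | _ = c≡0
  ... | no c≢0 | yes refl with p*q≡0⇒p≡0∨q≡0 c c on-curve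
  ...   | inj₁ c≡0 = c≡0
  ...   | inj₂ c≡0 = c≡0
  curve-point-on-axis {c} {y} on-curve | no c≢0 | no y≢0 =
    ⊥-elim (u⁴+1≢v² (c * i) (y * ½ - c * i * (c * i)) ci≢0 (curve⇒quartic c y i on-curve 2yi≡1))
    where
    2y≢0 : q 2 * y ≢ 0ℚ
    2y≢0 2y≡0 with p*q≡0⇒p≡0∨q≡0 (q 2) y 2y≡0
    ... | inj₂ y≡0 = y≢0 y≡0
    instance _ = ≢-nonZero 2y≢0
    i = 1/ (q 2 * y)
    2yi≡1 : q 2 * y * i ≡ 1ℚ
    2yi≡1 = ℚ.*-inverseʳ (q 2 * y)
    ci≢0 : c * i ≢ 0ℚ
    ci≢0 ci≡0 with p*q≡0⇒p≡0∨q≡0 c i ci≡0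
    ... | inj₁ c≡0 = c≢0 c≡0
    ... | inj₂ i≡0 with trans (sym 2yi≡1) (trans (cong (q 2 * y *_) i≡0) (ℚ.*-zeroʳ (q 2 * y)))
    ...   | ()

module Coefficients where
  open import Data.Nat as ℕ using (ℕ; zero; suc; _≤_; _<_; z≤n; s≤s; _∸_)
  import Data.Nat.Properties as ℕ
  open import Data.Rational using (ℚ; 0ℚ; 1ℚ; _+_; _*_)
  import Data.Rational.Properties as ℚ
  open import Data.List using ([]; _∷_; applyUpTo; map)
  open import Data.Product using (∃-syntax; _×_; _,_; proj₂)
  open import Data.Sum using (_⊎_; inj₁; inj₂)
  open import Data.Empty using (⊥-elim)
  open import Function using (_∘_)
  open import Relation.Nullary using (yes; no)
  open import Relation.Binary.Definitions using (tri<; tri≈; tri>)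
  open import Relation.Binary.PropositionalEquality
  open Combinations using (p*q≡0⇒p≡0∨q≡0)
  open import Data.Rational.Solver using (module +-*-Solver)
  open +-*-Solver using (solve; _:*_; _:=_)

  sumTo-cong : ∀ n {f g : ℕ → ℚ} → (∀ i → i ≤ n → f i ≡ g i) → sumTo n f ≡ sumTo n g
  sumTo-cong zero    f≗g = f≗g 0 z≤n
  sumTo-cong (suc n) f≗g = cong₂ _+_ (sumTo-cong n (λ i i≤n → f≗g i (ℕ.m≤n⇒m≤1+n i≤n))) (f≗g (suc n) ℕ.≤-refl)

  sumTo-zero : ∀ n {f} → (∀ i → i ≤ n → f i ≡ 0ℚ) → sumTo n f ≡ 0ℚ
  sumTo-zero n {f} f≗0 = trans (sumTo-cong n f≗0) (sumTo-const-0 n)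
    where
    sumTo-const-0 : ∀ n → sumTo n (λ _ → 0ℚ) ≡ 0ℚ
    sumTo-const-0 zero = refl
    sumTo-const-0 (suc n) = cong (_+ 0ℚ) (sumTo-const-0 n)

  sumTo-single : ∀ n {f} m → m ≤ n → (∀ i → i ≤ n → i ≢ m → f i ≡ 0ℚ) → sumTo n f ≡ f m
  sumTo-single zero    zero    _   _   = refl
  sumTo-single (suc n) {f} m m≤1+n f≗0 with m ℕ.≟ suc n
  ... | yes refl = trans (cong (_+ f (suc n)) (sumTo-zero n (λ i i≤n → f≗0 i (ℕ.m≤n⇒m≤1+n i≤n) (ℕ.<⇒≢ (s≤s i≤n)))))
                         (ℚ.+-identityˡ (f (suc n)))
  ... | no m≢1+n = trans (cong₂ _+_ (sumTo-single n m (ℕ.≤-pred (ℕ.≤∧≢⇒< m≤1+n m≢1+n)) (λ i i≤n → f≗0 i (ℕ.m≤n⇒m≤1+n i≤n)))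
                                    (f≗0 (suc n) ℕ.≤-refl (m≢1+n ∘ sym)))
                         (ℚ.+-identityʳ (f m))

  sumTo-suc : ∀ n f → sumTo (suc n) f ≡ f 0 + sumTo n (f ∘ suc)
  sumTo-suc zero    f = refl
  sumTo-suc (suc n) f = trans (cong (_+ f (suc (suc n))) (sumTo-suc n f)) (ℚ.+-assoc (f 0) _ _)

  sumTo-reverse : ∀ n f → sumTo n f ≡ sumTo n (λ i → f (n ∸ i))
  sumTo-reverse zero    f = refl
  sumTo-reverse (suc n) f = begin
    sumTo n f + f (suc n)                         ≡⟨ ℚ.+-comm _ (f (suc n)) ⟩
    f (suc n) + sumTo n f                         ≡⟨ cong (f (suc n) +_) (sumTo-reverse n f) ⟩
    f (suc n) + sumTo n (λ i → f (n ∸ i))         ≡⟨ sumTo-suc n (λ i → f (suc n ∸ i)) ⟨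
    sumTo (suc n) (λ i → f (suc n ∸ i))           ∎
    where open ≡-Reasoning

  mulCoeff-comm : ∀ g h k → mulCoeff g h k ≡ mulCoeff h g k
  mulCoeff-comm g h k = trans (sumTo-reverse k _) (sumTo-cong k λ i i≤k →
    trans (cong (λ j → coeff g (k ∸ i) * coeff h j) (ℕ.m∸[m∸n]≡n i≤k)) (ℚ.*-comm (coeff g (k ∸ i)) (coeff h i)))

  record Factorises (f g h : Poly) : Set where
    constructor factorises
    field
      coeff-≡ : ∀ k → coeff f k ≡ mulCoeff g h k

  Factorises-comm : ∀ {f g h} → Factorises f g h → Factorises f h g
  Factorises-comm {g = g} {h} (factorises f≡gh) = factorises λ k → trans (f≡gh k) (mulCoeff-comm g h k)

  _HasDegree_ : (ℕ → ℚ) → ℕ → Set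
  a HasDegree m = a m ≢ 0ℚ × (∀ k → m < k → a k ≡ 0ℚ)

  degree-unique : ∀ {a m n} → a HasDegree m → a HasDegree n → m ≡ n
  degree-unique {m = m} {n} (am≢0 , a>m≡0) (an≢0 , a>n≡0) with ℕ.<-cmp m n
  ... | tri< m<n _ _ = ⊥-elim (an≢0 (a>m≡0 n m<n))
  ... | tri≈ _ m≡n _ = m≡n
  ... | tri> _ _ n<m = ⊥-elim (am≢0 (a>n≡0 m n<m))

  HasDegree-cong : ∀ {a b m} → (∀ k → a k ≡ b k) → a HasDegree m → b HasDegree m
  HasDegree-cong a≗b (am≢0 , a>m≡0) = (λ bm≡0 → am≢0 (trans (a≗b _) bm≡0)) , λ k m<k → trans (sym (a≗b k)) (a>m≡0 k m<k)

  degree? : ∀ g → (∀ k → coeff g k ≡ 0ℚ) ⊎ ∃[ m ] coeff g HasDegree m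
  degree? [] = inj₁ λ _ → refl
  degree? (a ∷ g) with degree? g
  ... | inj₂ (m , gm≢0 , g>m≡0) = inj₂ (suc m , gm≢0 , λ { (suc k) (s≤s m<k) → g>m≡0 k m<k })
  ... | inj₁ g≡0 with a ℚ.≟ 0ℚ
  ...   | yes a≡0 = inj₁ λ { zero → a≡0 ; (suc k) → g≡0 k }
  ...   | no a≢0 = inj₂ (0 , a≢0 , λ { (suc k) _ → g≡0 k })

  nonConstant-degree : ∀ {g} → NonConstant g → ∃[ m ] 1 ≤ m × coeff g HasDegree m
  nonConstant-degree {g} (k , 1≤k , gk≢0) with degree? g
  ... | inj₁ g≡0 = ⊥-elim (gk≢0 (g≡0 k))
  ... | inj₂ (m , deg) = m , ℕ.≤-trans 1≤k (ℕ.≮⇒≥ λ m<k → gk≢0 (proj₂ deg k m<k)) , deg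

  <∸ : ∀ i {n k} → i ℕ.+ n < k → n < k ∸ i
  <∸ zero              lt      = lt
  <∸ (suc i) {k = suc k} (s≤s lt) = <∸ i lt

  mulCoeff-leading : ∀ {g h m n} → coeff g HasDegree m → coeff h HasDegree n →
                     mulCoeff g h (m ℕ.+ n) ≡ coeff g m * coeff h n
  mulCoeff-leading {g} {h} {m} {n} (_ , g>m≡0) (_ , h>n≡0) =
    trans (sumTo-single (m ℕ.+ n) m (ℕ.m≤m+n m n) other≡0) (cong (λ j → coeff g m * coeff h j) (ℕ.m+n∸m≡n m n))
    where
    other≡0 : ∀ i → i ≤ m ℕ.+ n → i ≢ m → coeff g i * coeff h (m ℕ.+ n ∸ i) ≡ 0ℚ
    other≡0 i _ i≢m with ℕ.<-cmp i m
    ... | tri< i<m _ _ = trans (cong (coeff g i *_) (h>n≡0 _ (<∸ i (ℕ.+-monoˡ-< n i<m)))) (ℚ.*-zeroʳ (coeff g i))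
    ... | tri≈ _ i≡m _ = ⊥-elim (i≢m i≡m)
    ... | tri> _ _ m<i = trans (cong (_* coeff h (m ℕ.+ n ∸ i)) (g>m≡0 i m<i)) (ℚ.*-zeroˡ (coeff h (m ℕ.+ n ∸ i)))

  mulCoeff-above : ∀ {g h m n} → coeff g HasDegree m → coeff h HasDegree n →
                   ∀ k → m ℕ.+ n < k → mulCoeff g h k ≡ 0ℚ
  mulCoeff-above {g} {h} {m} {n} (_ , g>m≡0) (_ , h>n≡0) k m+n<k = sumTo-zero k term≡0
    where
    term≡0 : ∀ i → i ≤ k → coeff g i * coeff h (k ∸ i) ≡ 0ℚ
    term≡0 i _ with m ℕ.<? i
    ... | yes m<i = trans (cong (_* coeff h (k ∸ i)) (g>m≡0 i m<i)) (ℚ.*-zeroˡ (coeff h (k ∸ i)))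
    ... | no m≮i = trans (cong (coeff g i *_) (h>n≡0 _ (<∸ i (ℕ.≤-<-trans (ℕ.+-monoˡ-≤ n (ℕ.≮⇒≥ m≮i)) m+n<k))))
                         (ℚ.*-zeroʳ (coeff g i))

  mulCoeff-degree : ∀ {g h m n} → coeff g HasDegree m → coeff h HasDegree n → mulCoeff g h HasDegree (m ℕ.+ n)
  mulCoeff-degree {g} {h} {m} {n} deg-g@(gm≢0 , _) deg-h@(hn≢0 , _) =
    leading≢0 , mulCoeff-above {g} {h} deg-g deg-h
    where
    leading≢0 : mulCoeff g h (m ℕ.+ n) ≢ 0ℚ
    leading≢0 eq with p*q≡0⇒p≡0∨q≡0 (coeff g m) (coeff h n) (trans (sym (mulCoeff-leading {g} {h} deg-g deg-h)) eq)
    ... | inj₁ gm≡0 = gm≢0 gm≡0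
    ... | inj₂ hn≡0 = hn≢0 hn≡0

  truncate : Poly → ℕ → Poly
  truncate g m = applyUpTo (coeff g) (suc m)

  coeff-applyUpTo-< : ∀ f {n k} → k < n → coeff (applyUpTo f n) k ≡ f k
  coeff-applyUpTo-< f {suc n} {zero}  _          = refl
  coeff-applyUpTo-< f {suc n} {suc k} (s≤s k<n) = coeff-applyUpTo-< (f ∘ suc) k<n

  coeff-applyUpTo-≥ : ∀ f {n k} → n ≤ k → coeff (applyUpTo f n) k ≡ 0ℚ
  coeff-applyUpTo-≥ f {zero}           _         = refl
  coeff-applyUpTo-≥ f {suc n} {suc k} (s≤s n≤k) = coeff-applyUpTo-≥ (f ∘ suc) n≤k

  truncate-≗ : ∀ {g m} → coeff g HasDegree m → ∀ k → coeff (truncate g m) k ≡ coeff g k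
  truncate-≗ {g} {m} (_ , g>m≡0) k with k ℕ.≤? m
  ... | yes k≤m = coeff-applyUpTo-< (coeff g) (s≤s k≤m)
  ... | no k≰m = trans (coeff-applyUpTo-≥ (coeff g) (ℕ.≰⇒> k≰m)) (sym (g>m≡0 k (ℕ.≰⇒> k≰m)))

  mulCoeff-cong : ∀ {g g′ h h′} → (∀ k → coeff g k ≡ coeff g′ k) → (∀ k → coeff h k ≡ coeff h′ k) →
                  ∀ k → mulCoeff g h k ≡ mulCoeff g′ h′ k
  mulCoeff-cong g≗g′ h≗h′ k = sumTo-cong k λ i _ → cong₂ _*_ (g≗g′ i) (h≗h′ (k ∸ i))

  P-degree : ∀ c → coeff (P c) HasDegree 6
  P-degree c = (λ ()) , above
    where
    above : ∀ k → 6 < k → coeff (P c) k ≡ 0ℚ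
    above k 6<k with ℕ.m≤n⇒∃[o]m+o≡n 6<k
    ... | _ , refl = refl

  scale : ℚ → Poly → Poly
  scale s = map (s *_)

  coeff-scale : ∀ s g k → coeff (scale s g) k ≡ s * coeff g k
  coeff-scale s []      k       = sym (ℚ.*-zeroʳ s)
  coeff-scale s (a ∷ g) zero    = refl
  coeff-scale s (a ∷ g) (suc k) = coeff-scale s g k

  sumTo-*ˡ : ∀ n a f → sumTo n (λ i → a * f i) ≡ a * sumTo n f
  sumTo-*ˡ zero    a f = refl
  sumTo-*ˡ (suc n) a f = trans (cong (_+ a * f (suc n)) (sumTo-*ˡ n a f)) (sym (ℚ.*-distribˡ-+ a _ _))

  mulCoeff-scale : ∀ s t g h k → mulCoeff (scale s g) (scale t h) k ≡ s * t * mulCoeff g h k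
  mulCoeff-scale s t g h k = trans (sumTo-cong k λ i _ → term i) (sumTo-*ˡ k (s * t) _)
    where
    interchange : ∀ x y → s * x * (t * y) ≡ s * t * (x * y)
    interchange = solve 4 (λ s t x y → s :* x :* (t :* y) := s :* t :* (x :* y)) refl s t
    term : ∀ i → coeff (scale s g) i * coeff (scale t h) (k ∸ i) ≡ s * t * (coeff g i * coeff h (k ∸ i))
    term i = trans (cong₂ _*_ (coeff-scale s g i) (coeff-scale t h (k ∸ i))) (interchange _ _)

  Factorises-scale : ∀ {f g h} s t → s * t ≡ 1ℚ → Factorises f g h → Factorises f (scale s g) (scale t h)
  Factorises-scale {f} {g} {h} s t st≡1 (factorises f≡gh) = factorises λ k → begin
    coeff f k                           ≡⟨ f≡gh k ⟩
    mulCoeff g h k                      ≡⟨ ℚ.*-identityˡ _ ⟨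
    1ℚ * mulCoeff g h k                 ≡⟨ cong (_* mulCoeff g h k) st≡1 ⟨
    s * t * mulCoeff g h k              ≡⟨ mulCoeff-scale s t g h k ⟨
    mulCoeff (scale s g) (scale t h) k  ∎
    where open ≡-Reasoning

  record MonicSplitting (c : ℚ) : Set where
    field
      m n     : ℕ
      1≤m     : 1 ≤ m
      1≤n     : 1 ≤ n
      m+n≡6   : m ℕ.+ n ≡ 6
      g h     : Poly
      leading : coeff g m * coeff h n ≡ 1ℚ
      monic   : Factorises (P c) (scale (coeff h n) (truncate g m)) (scale (coeff g m) (truncate h n))

  monic-splitting : ∀ {c} → Reducible (P c) → MonicSplitting c
  monic-splitting {c} (g , h , g-nonConstant , h-nonConstant , P≡gh)
    with nonConstant-degree {g} g-nonConstant | nonConstant-degree {h} h-nonConstant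
  ... | m , 1≤m , deg-g | n , 1≤n , deg-h = record
    { m = m ; n = n ; 1≤m = 1≤m ; 1≤n = 1≤n ; m+n≡6 = m+n≡6 ; g = g ; h = h ; leading = leading
    ; monic = Factorises-scale (coeff h n) (coeff g m) (trans (ℚ.*-comm (coeff h n) (coeff g m)) leading) truncated }
    where
    m+n≡6 : m ℕ.+ n ≡ 6
    m+n≡6 = degree-unique (HasDegree-cong (λ k → sym (P≡gh k)) (mulCoeff-degree {g} {h} deg-g deg-h)) (P-degree c)
    leading : coeff g m * coeff h n ≡ 1ℚ
    leading = begin
      coeff g m * coeff h n     ≡⟨ mulCoeff-leading {g} {h} deg-g deg-h ⟨
      mulCoeff g h (m ℕ.+ n)    ≡⟨ P≡gh (m ℕ.+ n) ⟨
      coeff (P c) (m ℕ.+ n)     ≡⟨ cong (coeff (P c)) m+n≡6 ⟩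
      1ℚ                        ∎
      where open ≡-Reasoning
    truncated : Factorises (P c) (truncate g m) (truncate h n)
    truncated = factorises λ k → trans (P≡gh k)
      (mulCoeff-cong {g} {truncate g m} {h} {truncate h n} (λ i → sym (truncate-≗ {g} deg-g i)) (λ i → sym (truncate-≗ {h} deg-h i)) k)

module FactorShapes where
  open import Data.Nat as ℕ using (ℕ; zero; suc; _∸_)
  open import Data.Rational using (ℚ; 0ℚ; 1ℚ; _+_; _*_; -_; _-_)
  import Data.Rational.Properties as ℚ
  open import Data.Rational.Solver using (module +-*-Solver)
  open import Data.List using (List; []; _∷_)
  open import Data.Product using (∃-syntax; _×_; _,_)
  open import Data.Sum using (_⊎_; inj₁; inj₂; [_,_]′)
  open import Function using (_∘_)
  open import Relation.Binary.PropositionalEquality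
  open Combinations using (zero-*; zero-+; difference; by-combination; p*q≡0⇒p≡0∨q≡0)
  open Coefficients using (Factorises; module Factorises)
  open +-*-Solver using (Polynomial; solve; _:+_; _:*_; _:-_; :-_; _:=_; con)

  CurvePoint : ℚ → Set
  CurvePoint c = ∃[ y ] c * c ≡ y * y * y - q 4 * y

  Parametrised : ℚ → Set
  Parametrised c = ∃[ v ] v ≢ 0ℚ × c * (q 8 * v) ≡ v * v * v * v + q 16

  -- Syntactic copies of coeff, sumTo, mulCoeff and P: the solver's semantics of mulCoeffᵉ gs hs k
  -- unfolds to mulCoeff of the evaluated lists, so residuals of a factorisation can enter `solve`.
  coeffᵉ : ∀ {n} → List (Polynomial n) → ℕ → Polynomial n
  coeffᵉ []      _       = con 0ℚ
  coeffᵉ (a ∷ p) zero    = a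
  coeffᵉ (a ∷ p) (suc k) = coeffᵉ p k

  sumToᵉ : ∀ {n} → ℕ → (ℕ → Polynomial n) → Polynomial n
  sumToᵉ zero    f = f zero
  sumToᵉ (suc n) f = sumToᵉ n f :+ f (suc n)

  mulCoeffᵉ : ∀ {n} → List (Polynomial n) → List (Polynomial n) → ℕ → Polynomial n
  mulCoeffᵉ p r k = sumToᵉ k (λ i → coeffᵉ p i :* coeffᵉ r (k ∸ i))

  Pᵉ : ∀ {n} → Polynomial n → List (Polynomial n)
  Pᵉ c = :- (c :* c) ∷ con 0ℚ ∷ :- con (q 4) ∷ con 0ℚ ∷ con 0ℚ ∷ con 0ℚ ∷ con 1ℚ ∷ []

  residualᵉ : ∀ {n} → Polynomial n → List (Polynomial n) → List (Polynomial n) → ℕ → Polynomial n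
  residualᵉ c g h k = coeffᵉ (Pᵉ c) k :- mulCoeffᵉ g h k

  _^_ : ℚ → ℕ → ℚ
  x ^ zero  = 1ℚ
  x ^ suc n = x ^ n * x

  _^ᵉ_ : ∀ {n} → Polynomial n → ℕ → Polynomial n
  x ^ᵉ zero  = con 1ℚ
  x ^ᵉ suc n = x ^ᵉ n :* x

  residual : ∀ {f g h} → Factorises f g h → ∀ k → coeff f k - mulCoeff g h k ≡ 0ℚ
  residual f≡gh k = difference (Factorises.coeff-≡ f≡gh k)

  weighted-residuals : ∀ {f g h} → Factorises f g h → ∀ (w : ℕ → ℚ) n →
                       sumTo n (λ k → w k * (coeff f k - mulCoeff g h k)) ≡ 0ℚ
  weighted-residuals f≡gh w zero = zero-* (w 0) (residual f≡gh 0)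
  weighted-residuals f≡gh w (suc n) = zero-+ (weighted-residuals f≡gh w n) (zero-* (w (suc n)) (residual f≡gh (suc n)))

  -- The weights evaluate P − gh at the root −r of the linear factor.
  linear-factor : ∀ {c r ℓ h₀ h₁ h₂ h₃ h₄ ℓ′} → ℓ ≡ 1ℚ → ℓ′ ≡ 1ℚ →
    Factorises (P c) (r ∷ ℓ ∷ []) (h₀ ∷ h₁ ∷ h₂ ∷ h₃ ∷ h₄ ∷ ℓ′ ∷ []) → CurvePoint c
  linear-factor {c} {r} {_} {h₀} {h₁} {h₂} {h₃} {h₄} refl refl P≡gh = r * r ,
    by-combination (weighted-residuals P≡gh (λ k → - (- r) ^ k) 6)
      (solve 7 (λ c r h₀ h₁ h₂ h₃ h₄ → c :* c :- (r :* r :* (r :* r) :* (r :* r) :- con (q 4) :* (r :* r))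
                := sumToᵉ 6 (λ k → :- ((:- r) ^ᵉ k) :* residualᵉ c (r ∷ con 1ℚ ∷ []) (h₀ ∷ h₁ ∷ h₂ ∷ h₃ ∷ h₄ ∷ con 1ℚ ∷ []) k))
         refl c r h₀ h₁ h₂ h₃ h₄)

  quadraticᵉ : ∀ {n} (c r p δ γ β α : Polynomial n) → ℕ → Polynomial n
  quadraticᵉ c r p δ γ β α = residualᵉ c (r ∷ p ∷ con 1ℚ ∷ []) (δ ∷ γ ∷ β ∷ α ∷ con 1ℚ ∷ [])

  quadratic-factor-explicit : ∀ {c r p δ γ β α} →
    α ≡ - p → β ≡ p * p - r → γ ≡ q 2 * p * r - p * p * p → δ ≡ p * p * p * p - q 3 * p * p * r + r * r - q 4 →
    Factorises (P c) (r ∷ p ∷ 1ℚ ∷ []) (δ ∷ γ ∷ β ∷ α ∷ 1ℚ ∷ []) → CurvePoint c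
  quadratic-factor-explicit {c} {r} {p} refl refl refl refl E = [ p≡0-case , K≡0-case ]′ (p*q≡0⇒p≡0∨q≡0 p K pK≡0)
    where
    Qᵉ : ∀ {n} (c r p : Polynomial n) → ℕ → Polynomial n
    Qᵉ c r p = quadraticᵉ c r p (p :* p :* p :* p :- con (q 3) :* p :* p :* r :+ r :* r :- con (q 4))
                              (con (q 2) :* p :* r :- p :* p :* p) (p :* p :- r) (:- p)
    K = q 3 * r * r - q 4 * p * p * r + p * p * p * p - q 4
    pK≡0 : p * K ≡ 0ℚ
    pK≡0 = by-combination (zero-* (- 1ℚ) (residual E 1)) (solve 3 (λ c r p →
      p :* (con (q 3) :* r :* r :- con (q 4) :* p :* p :* r :+ p :* p :* p :* p :- con (q 4)) :- con 0ℚ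
      := :- con 1ℚ :* Qᵉ c r p 1) refl c r p)
    p≡0-case : p ≡ 0ℚ → CurvePoint c
    p≡0-case p≡0 = - r , by-combination
      (zero-+ (zero-* (- 1ℚ) (residual E 0)) (zero-* (q 3 * p * r * r - r * p * p * p) (difference p≡0)))
      (solve 3 (λ c r p → c :* c :- ((:- r) :* (:- r) :* (:- r) :- con (q 4) :* (:- r))
         := :- con 1ℚ :* Qᵉ c r p 0 :+ (con (q 3) :* p :* r :* r :- r :* p :* p :* p) :* (p :- con 0ℚ)) refl c r p)
    K≡0-case : K ≡ 0ℚ → CurvePoint c
    K≡0-case K≡0 = q 2 * r - p * p , by-combination
      (zero-+ (zero-* (- 1ℚ) (residual E 0)) (zero-* (- (q 3 * r - p * p)) K≡0))
      (solve 3 (λ c r p → c :* c :- ((con (q 2) :* r :- p :* p) :* (con (q 2) :* r :- p :* p) :* (con (q 2) :* r :- p :* p)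
                                      :- con (q 4) :* (con (q 2) :* r :- p :* p))
         := :- con 1ℚ :* Qᵉ c r p 0
            :+ :- (con (q 3) :* r :- p :* p) :* (con (q 3) :* r :* r :- con (q 4) :* p :* p :* r :+ p :* p :* p :* p :- con (q 4)))
         refl c r p)

  -- Synthetic division: the residual multipliers are the coefficients of the partial quotients.
  quadratic-factor : ∀ {c r p ℓ δ γ β α ℓ′} → ℓ ≡ 1ℚ → ℓ′ ≡ 1ℚ →
    Factorises (P c) (r ∷ p ∷ ℓ ∷ []) (δ ∷ γ ∷ β ∷ α ∷ ℓ′ ∷ []) → CurvePoint c
  quadratic-factor {c} {r} {p} {_} {δ} {γ} {β} {α} refl refl E = quadratic-factor-explicit {c} α≡ β≡ γ≡ δ≡ E
    where
    α≡ : α ≡ - p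
    α≡ = by-combination (zero-* (- 1ℚ) (residual E 5))
      (solve 7 (λ c r p δ γ β α → α :- :- p := :- con 1ℚ :* quadraticᵉ c r p δ γ β α 5) refl c r p δ γ β α)
    β≡ : β ≡ p * p - r
    β≡ = by-combination (zero-+ (zero-* (- 1ℚ) (residual E 4)) (zero-* p (residual E 5)))
      (solve 7 (λ c r p δ γ β α → β :- (p :* p :- r)
         := :- con 1ℚ :* quadraticᵉ c r p δ γ β α 4 :+ p :* quadraticᵉ c r p δ γ β α 5) refl c r p δ γ β α)
    γ≡ : γ ≡ q 2 * p * r - p * p * p
    γ≡ = by-combination (zero-+ (zero-+ (zero-* (- 1ℚ) (residual E 3)) (zero-* p (residual E 4))) (zero-* (- (p * p - r)) (residual E 5)))
      (solve 7 (λ c r p δ γ β α → γ :- (con (q 2) :* p :* r :- p :* p :* p)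
         := :- con 1ℚ :* quadraticᵉ c r p δ γ β α 3 :+ p :* quadraticᵉ c r p δ γ β α 4
            :+ :- (p :* p :- r) :* quadraticᵉ c r p δ γ β α 5) refl c r p δ γ β α)
    δ≡ : δ ≡ p * p * p * p - q 3 * p * p * r + r * r - q 4
    δ≡ = by-combination
      (zero-+ (zero-+ (zero-+ (zero-* (- 1ℚ) (residual E 2)) (zero-* p (residual E 3)))
                      (zero-* (- (p * p - r)) (residual E 4))) (zero-* (- (q 2 * p * r - p * p * p)) (residual E 5)))
      (solve 7 (λ c r p δ γ β α → δ :- (p :* p :* p :* p :- con (q 3) :* p :* p :* r :+ r :* r :- con (q 4))
         := :- con 1ℚ :* quadraticᵉ c r p δ γ β α 2 :+ p :* quadraticᵉ c r p δ γ β α 3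
            :+ :- (p :* p :- r) :* quadraticᵉ c r p δ γ β α 4
            :+ :- (con (q 2) :* p :* r :- p :* p :* p) :* quadraticᵉ c r p δ γ β α 5) refl c r p δ γ β α)

  parametrised : ∀ {a c d} → q 8 * a * d ≡ a * a * a * a + q 16 → c * c ≡ d * d → Parametrised c
  parametrised {a} {c} {d} 8ad≡a⁴+16 c²≡d² =
    [ c≡d-case , c≡-d-case ]′ (p*q≡0⇒p≡0∨q≡0 (c - d) (c + d)
                                 (by-combination (difference c²≡d²) (solve 2 (λ c d → (c :- d) :* (c :+ d) :- con 0ℚ := c :* c :- d :* d) refl c d)))
    where
    a≢0 : a ≢ 0ℚ
    a≢0 a≡0 = 16≢0 (by-combination
      (zero-+ (zero-* (- 1ℚ) (difference 8ad≡a⁴+16)) (zero-* (q 8 * d - a * a * a) (difference a≡0)))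
      (solve 2 (λ a d → con (q 16) :- con 0ℚ
         := :- con 1ℚ :* (con (q 8) :* a :* d :- (a :* a :* a :* a :+ con (q 16))) :+ (con (q 8) :* d :- a :* a :* a) :* (a :- con 0ℚ))
         refl a d))
      where
      16≢0 : q 16 ≢ 0ℚ
      16≢0 ()
    c≡d-case : c - d ≡ 0ℚ → Parametrised c
    c≡d-case c-d≡0 = a , a≢0 , by-combination (zero-+ (difference 8ad≡a⁴+16) (zero-* (q 8 * a) c-d≡0))
      (solve 3 (λ a c d → c :* (con (q 8) :* a) :- (a :* a :* a :* a :+ con (q 16))
         := (con (q 8) :* a :* d :- (a :* a :* a :* a :+ con (q 16))) :+ con (q 8) :* a :* (c :- d)) refl a c d)
    c≡-d-case : c + d ≡ 0ℚ → Parametrised c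
    c≡-d-case c+d≡0 = - a , a≢0 ∘ ℚ.neg-injective {a} {0ℚ} , by-combination (zero-+ (difference 8ad≡a⁴+16) (zero-* (- (q 8 * a)) c+d≡0))
      (solve 3 (λ a c d → c :* (con (q 8) :* :- a) :- (:- a :* :- a :* :- a :* :- a :+ con (q 16))
         := (con (q 8) :* a :* d :- (a :* a :* a :* a :+ con (q 16))) :+ :- (con (q 8) :* a) :* (c :+ d)) refl a c d)

  cubicᵉ : ∀ {n} (c d b a D B A : Polynomial n) → ℕ → Polynomial n
  cubicᵉ c d b a D B A = residualᵉ c (d ∷ b ∷ a ∷ con 1ℚ ∷ []) (D ∷ B ∷ A ∷ con 1ℚ ∷ [])

  cubic-factor-explicit : ∀ {c d b a D B A} → A ≡ - a → B ≡ a * a - b → D ≡ q 2 * a * b - a * a * a - d →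
    Factorises (P c) (d ∷ b ∷ a ∷ 1ℚ ∷ []) (D ∷ B ∷ A ∷ 1ℚ ∷ []) → CurvePoint c ⊎ Parametrised c
  cubic-factor-explicit {c} {d} {b} {a} refl refl refl E = [ a²≡2b-case , d≡ab-case ]′ (p*q≡0⇒p≡0∨q≡0 (a * a - q 2 * b) (d - a * b) key)
    where
    Rᵉ : ∀ {n} (c d b a : Polynomial n) → ℕ → Polynomial n
    Rᵉ c d b a = cubicᵉ c d b a (con (q 2) :* a :* b :- a :* a :* a :- d) (a :* a :- b) (:- a)
    key : (a * a - q 2 * b) * (d - a * b) ≡ 0ℚ
    key = by-combination (zero-* (- 1ℚ) (residual E 1)) (solve 4 (λ c d b a →
      (a :* a :- con (q 2) :* b) :* (d :- a :* b) :- con 0ℚ := :- con 1ℚ :* Rᵉ c d b a 1) refl c d b a)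
    d≡ab-case : d - a * b ≡ 0ℚ → CurvePoint c ⊎ Parametrised c
    d≡ab-case d-ab≡0 = inj₁ (a * a , by-combination
      (zero-+ (zero-+ (zero-* (- 1ℚ) (residual E 0)) (zero-* (- (a * a)) (residual E 2)))
              (zero-* (d - a * b + q 3 * a * a * a) d-ab≡0))
      (solve 4 (λ c d b a → c :* c :- (a :* a :* (a :* a) :* (a :* a) :- con (q 4) :* (a :* a))
         := :- con 1ℚ :* Rᵉ c d b a 0 :+ :- (a :* a) :* Rᵉ c d b a 2 :+ (d :- a :* b :+ con (q 3) :* a :* a :* a) :* (d :- a :* b))
         refl c d b a))
    a²≡2b-case : a * a - q 2 * b ≡ 0ℚ → CurvePoint c ⊎ Parametrised c
    a²≡2b-case a²-2b≡0 = inj₂ (parametrised {a} {c} {d}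
      (by-combination (zero-+ (zero-* (q 4) (residual E 2)) (zero-* (q 2 * b - q 5 * a * a) a²-2b≡0))
        (solve 4 (λ c d b a → con (q 8) :* a :* d :- (a :* a :* a :* a :+ con (q 16))
           := con (q 4) :* Rᵉ c d b a 2 :+ (con (q 2) :* b :- con (q 5) :* a :* a) :* (a :* a :- con (q 2) :* b)) refl c d b a))
      (by-combination (zero-+ (zero-* (- 1ℚ) (residual E 0)) (zero-* (a * d) a²-2b≡0))
        (solve 4 (λ c d b a → c :* c :- d :* d
           := :- con 1ℚ :* Rᵉ c d b a 0 :+ a :* d :* (a :* a :- con (q 2) :* b)) refl c d b a)))

  cubic-factor : ∀ {c d b a ℓ D B A ℓ′} → ℓ ≡ 1ℚ → ℓ′ ≡ 1ℚ →
    Factorises (P c) (d ∷ b ∷ a ∷ ℓ ∷ []) (D ∷ B ∷ A ∷ ℓ′ ∷ []) → CurvePoint c ⊎ Parametrised c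
  cubic-factor {c} {d} {b} {a} {_} {D} {B} {A} refl refl E = cubic-factor-explicit {c} A≡ B≡ D≡ E
    where
    A≡ : A ≡ - a
    A≡ = by-combination (zero-* (- 1ℚ) (residual E 5))
      (solve 7 (λ c d b a D B A → A :- :- a := :- con 1ℚ :* cubicᵉ c d b a D B A 5) refl c d b a D B A)
    B≡ : B ≡ a * a - b
    B≡ = by-combination (zero-+ (zero-* (- 1ℚ) (residual E 4)) (zero-* a (residual E 5)))
      (solve 7 (λ c d b a D B A → B :- (a :* a :- b)
         := :- con 1ℚ :* cubicᵉ c d b a D B A 4 :+ a :* cubicᵉ c d b a D B A 5) refl c d b a D B A)
    D≡ : D ≡ q 2 * a * b - a * a * a - d
    D≡ = by-combination (zero-+ (zero-+ (zero-* (- 1ℚ) (residual E 3)) (zero-* a (residual E 4))) (zero-* (- (a * a - b)) (residual E 5)))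
      (solve 7 (λ c d b a D B A → D :- (con (q 2) :* a :* b :- a :* a :* a :- d)
         := :- con 1ℚ :* cubicᵉ c d b a D B A 3 :+ a :* cubicᵉ c d b a D B A 4
            :+ :- (a :* a :- b) :* cubicᵉ c d b a D B A 5) refl c d b a D B A)

open import Data.Nat as ℕ using (zero; suc; _≤_)
open import Data.Rational using (ℚ; 0ℚ; 1ℚ; _+_; _*_; -_; _÷_; 1/_; ≢-nonZero; NonZero)
import Data.Rational.Properties as ℚ
open import Data.Rational.Solver using (module +-*-Solver)
open import Data.Product using (Σ; _,_)
open import Data.Sum using (_⊎_; inj₁; [_,_]′)
open import Data.Empty using (⊥-elim)
open import Relation.Binary.PropositionalEquality
open Combinations using (zero-*; zero-+; difference; by-combination)
open CurvePoints using (curve-point-on-axis)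
open Coefficients using (Factorises; Factorises-comm; scale; truncate; MonicSplitting; monic-splitting)
open FactorShapes using (CurvePoint; Parametrised; linear-factor; quadratic-factor; cubic-factor)
open +-*-Solver using (solve; _:+_; _:*_; _:-_; :-_; _:=_; con)

split-by-degree : ∀ {c} m {n} g h → 1 ≤ m → 1 ≤ n → m ℕ.+ n ≡ 6 →
  coeff h n * coeff g m ≡ 1ℚ → coeff g m * coeff h n ≡ 1ℚ →
  Factorises (P c) (scale (coeff h n) (truncate g m)) (scale (coeff g m) (truncate h n)) → CurvePoint c ⊎ Parametrised c
split-by-degree {c} 1 g h _ _ refl ℓ≡1 ℓ′≡1 E = inj₁ (linear-factor {c} ℓ≡1 ℓ′≡1 E)
split-by-degree {c} 2 g h _ _ refl ℓ≡1 ℓ′≡1 E = inj₁ (quadratic-factor {c} ℓ≡1 ℓ′≡1 E)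
split-by-degree {c} 3 g h _ _ refl ℓ≡1 ℓ′≡1 E = cubic-factor {c} ℓ≡1 ℓ′≡1 E
split-by-degree {c} 4 g h _ _ refl ℓ≡1 ℓ′≡1 E = inj₁ (quadratic-factor {c} ℓ′≡1 ℓ≡1 (Factorises-comm E))
split-by-degree {c} 5 g h _ _ refl ℓ≡1 ℓ′≡1 E = inj₁ (linear-factor {c} ℓ′≡1 ℓ≡1 (Factorises-comm E))
split-by-degree 6 {zero} g h _ () _ _ _ _
split-by-degree (suc (suc (suc (suc (suc (suc (suc _))))))) g h _ _ () _ _ _

reducible⇒curve-point⊎parametrised : ∀ {c} → Reducible (P c) → CurvePoint c ⊎ Parametrised c
reducible⇒curve-point⊎parametrised {c} R = split-by-degree {c} m g h 1≤m 1≤n m+n≡6 (trans (ℚ.*-comm (coeff h n) (coeff g m)) leading) leading monic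
  where open MonicSplitting (monic-splitting {c} R)

c*[k*v]≡w⇒c≡w÷k÷v : ∀ {c k v w} .{{_ : NonZero k}} .{{_ : NonZero v}} → c * (k * v) ≡ w → c ≡ (w ÷ k) ÷ v
c*[k*v]≡w⇒c≡w÷k÷v {c} {k} {v} {w} ckv≡w = by-combination
  (zero-+ (zero-+ (zero-* (1/ k * 1/ v) (difference ckv≡w)) (zero-* (- (c * v * 1/ v)) (difference (ℚ.*-inverseʳ k))))
          (zero-* (- c) (difference (ℚ.*-inverseʳ v))))
  (solve 6 (λ c k v w i j → c :- w :* i :* j
     := i :* j :* (c :* (k :* v) :- w) :+ :- (c :* v :* j) :* (k :* i :- con 1ℚ) :+ :- c :* (v :* j :- con 1ℚ))
     refl c k v w (1/ k) (1/ v))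

parametrised⇒c≡[v⁴+16]/8v : ∀ {c} → Parametrised c →
  Σ ℚ λ v → Σ (v ≢ 0ℚ) λ v≢0 → c ≡ _÷_ ((v * v * v * v + q 16) ÷ q 8) v {{≢-nonZero v≢0}}
parametrised⇒c≡[v⁴+16]/8v {c} (v , v≢0 , c8v≡v⁴+16) = v , v≢0 , c*[k*v]≡w⇒c≡w÷k÷v {c} {q 8} {v} {{_}} {{≢-nonZero v≢0}} c8v≡v⁴+16

proposition4p4 : (c : ℚ) → c ≢ 0ℚ → Reducible (P c) →
    Σ ℚ λ v → Σ (v ≢ 0ℚ) λ v≢0 →
    c ≡ _÷_ ((v * v * v * v + q 16) ÷ q 8) v {{≢-nonZero v≢0}}
proposition4p4 c c≢0 R =
  [ (λ (y , on-curve) → ⊥-elim (c≢0 (curve-point-on-axis {c} {y} on-curve))) , parametrised⇒c≡[v⁴+16]/8v {c} ]′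
  (reducible⇒curve-point⊎parametrised {c} R)
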